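{- Let $(a_{ij})$ be an $m\times n$ array of integers and for $\varepsilon>0$ let $M(\varepsilon)$ be the $m\times n$ matrix with entries $\varepsilon^{a_{ij}}$. Suppose there is $\varepsilon_0>0$ such that $M(\varepsilon)$ is $2$-positive for all $0<\varepsilon<\varepsilon_0$. Then there is $\varepsilon_1>0$ such that $M(\varepsilon)$ is totally positive for all $0<\varepsilon<\varepsilon_1$.
   Context: A matrix is $2$-positive if all its entries and all its $2\times 2$ minors are positive, and totally positive if all its minors (determinants of square submatrices of every order) are positive.
   Formalization: The parameter ε and the bounds ε₀ and ε₁ range over the positive rationals. -}

module Defs where

open import Data.Nat using (ℕ; zero; suc)
open import Data.Integer using (ℤ; +_; -[1+_])
open import Data.Fin using (Fin; zero; suc; punchIn; _<_)
open import Data.Rational using (ℚ; 0ℚ; 1ℚ; _+_; _*_; -_; 1/_; _>_; >-nonZero)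

_^ℕ_ : ℚ → ℕ → ℚ
x ^ℕ zero  = 1ℚ
x ^ℕ suc k = x * (x ^ℕ k)

pow : (ε : ℚ) → ε > 0ℚ → ℤ → ℚ
pow ε p (+ k)      = ε ^ℕ k
pow ε p (-[1+ k ]) = ((1/ ε) {{>-nonZero p}}) ^ℕ suc k

M : ∀ {m n} → (Fin m → Fin n → ℤ) → (ε : ℚ) → ε > 0ℚ → Fin m → Fin n → ℚ
M a ε p i j = pow ε p (a i j)

sumFin : ∀ {k} → (Fin k → ℚ) → ℚ
sumFin {zero}  f = 0ℚ
sumFin {suc k} f = f zero + sumFin (λ i → f (suc i))

sgn : ∀ {k} → Fin k → ℚ
sgn zero    = 1ℚ
sgn (suc j) = - sgn j

det : ∀ {k} → (Fin k → Fin k → ℚ) → ℚ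
det {zero}  A = 1ℚ
det {suc k} A = sumFin (λ j → sgn j * (A zero j * det (λ r c → A (suc r) (punchIn j c))))

-- strictly increasing index selection (a k-element subset of Fin m, listed in order)
StrictlyIncreasing : ∀ {k m} → (Fin k → Fin m) → Set
StrictlyIncreasing {k} f = ∀ (i j : Fin k) → i < j → f i < f j

minor : ∀ {m n k} → (Fin m → Fin n → ℚ) → (Fin k → Fin m) → (Fin k → Fin n) → ℚ
minor A I J = det (λ r c → A (I r) (J c))

MinorsPositive : ℕ → ∀ {m n} → (Fin m → Fin n → ℚ) → Set
MinorsPositive k {m} {n} A = ∀ (I : Fin k → Fin m) (J : Fin k → Fin n) →
  StrictlyIncreasing I → StrictlyIncreasing J → minor A I J > 0ℚ

TwoPositive : ∀ {m n} → (Fin m → Fin n → ℚ) → Set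
TwoPositive A = MinorsPositive 1 A × MinorsPositive 2 A
  where open import Data.Product using (_×_)

TotallyPositive : ∀ {m n} → (Fin m → Fin n → ℚ) → Set
TotallyPositive A = ∀ (k : ℕ) → MinorsPositive (suc k) A

-- If a_ij + a_i'j' ≥ a_ij' + a_i'j for some i < i' and j < j', the corresponding 2 × 2 minor of M(ε)
-- is ≤ 0 for every ε ≤ 1; so 2-positivity for small ε makes the exponent array strictly Monge, and
-- with it every square subarray.  For a strictly Monge array b the diagonal is the unique permutation
-- of least exponent: in the first-row Laplace expansion the column-0 term has exponent trace b and
-- every other term a strictly larger one.  Induction on the order then gives
-- ∣det ε^b − ε^(trace b)∣ ≤ K k · ε^(trace b) · ε, so all minors are positive once K m · ε < 1.
module Submission where

open import Defs
open import Data.Nat as ℕ using (ℕ; zero; suc)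
import Data.Nat.Properties as ℕᵖ
open import Data.Integer as ℤ using (ℤ; 0ℤ; +_; -[1+_]; _⊖_)
import Data.Integer.Properties as ℤᵖ
open import Data.Fin as Fin using (Fin; zero; suc; punchIn)
import Data.Fin.Properties as Finᵖ
open import Data.Rational
  using (ℚ; 0ℚ; 1ℚ; ½; _+_; _*_; -_; _-_; 1/_; ∣_∣; _<_; _>_; _≤_
        ; Positive; NonNegative; NonZero; positive; >-nonZero)
open import Data.Rational.Properties
open import Data.Rational.Solver using (module +-*-Solver)
open import Data.Product using (Σ; _×_; _,_)
open import Data.Empty using (⊥-elim)
open import Function using (_∘_)
open import Function.Definitions using (Injective)
open import Relation.Binary.Definitions using (tri<; tri≈; tri>)
open import Relation.Binary.PropositionalEquality
open import Relation.Nullary using (yes; no)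
open import Relation.Nullary.Decidable using (from-yes)

open +-*-Solver

p≤p+q : ∀ p q .{{_ : NonNegative q}} → p ≤ p + q
p≤p+q p q = ≤-trans (≤-reflexive (sym (+-identityʳ p))) (+-monoʳ-≤ p (nonNegative⁻¹ q))

p≤∣p∣ : ∀ p → p ≤ ∣ p ∣
p≤∣p∣ p with 0ℚ ≤? p
... | yes 0≤p = ≤-reflexive (sym (0≤p⇒∣p∣≡p 0≤p))
... | no  0≰p = ≤-trans (<⇒≤ (≰⇒> 0≰p)) (0≤∣p∣ p)

∣p∣≤∣p-q∣+∣q∣ : ∀ p q → ∣ p ∣ ≤ ∣ p - q ∣ + ∣ q ∣
∣p∣≤∣p-q∣+∣q∣ p q = begin
  ∣ p ∣             ≡⟨ cong ∣_∣ (solve 2 (λ p q → p := (p :- q) :+ q) refl p q) ⟩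
  ∣ (p - q) + q ∣   ≤⟨ ∣p+q∣≤∣p∣+∣q∣ (p - q) q ⟩
  ∣ p - q ∣ + ∣ q ∣ ∎
  where open ≤-Reasoning

∣p-q∣≤r⇒q-r≤p : ∀ {p q r} → ∣ p - q ∣ ≤ r → q - r ≤ p
∣p-q∣≤r⇒q-r≤p {p} {q} {r} ∣p-q∣≤r = begin
  q - r             ≡⟨ solve 3 (λ p q r → q :- r := (:- (p :- q)) :+ (p :- r)) refl p q r ⟩
  - (p - q) + (p - r) ≤⟨ +-monoˡ-≤ (p - r) (≤-trans (p≤∣p∣ _) (≤-trans (≤-reflexive (∣-p∣≡∣p∣ (p - q))) ∣p-q∣≤r)) ⟩
  r + (p - r)       ≡⟨ solve 2 (λ p r → r :+ (p :- r) := p) refl p r ⟩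
  p                 ∎
  where open ≤-Reasoning

∣p*q∣≡p*∣q∣ : ∀ p q .{{_ : NonNegative p}} → ∣ p * q ∣ ≡ p * ∣ q ∣
∣p*q∣≡p*∣q∣ p q = trans (∣p*q∣≡∣p∣*∣q∣ p q) (cong (_* ∣ q ∣) (0≤p⇒∣p∣≡p (nonNegative⁻¹ p)))

∣sgn∣≡1 : ∀ {k} (j : Fin k) → ∣ sgn j ∣ ≡ 1ℚ
∣sgn∣≡1 zero    = refl
∣sgn∣≡1 (suc j) = trans (∣-p∣≡∣p∣ (sgn j)) (∣sgn∣≡1 j)

∣sgn*p∣≡∣p∣ : ∀ {k} (j : Fin k) p → ∣ sgn j * p ∣ ≡ ∣ p ∣
∣sgn*p∣≡∣p∣ j p = trans (∣p*q∣≡∣p∣*∣q∣ (sgn j) p) (trans (cong (_* ∣ p ∣) (∣sgn∣≡1 j)) (*-identityˡ ∣ p ∣))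

fromℕ : ℕ → ℚ
fromℕ zero    = 0ℚ
fromℕ (suc k) = 1ℚ + fromℕ k

fromℕ-nonNegative : ∀ k → NonNegative (fromℕ k)
fromℕ-nonNegative zero    = _
fromℕ-nonNegative (suc k) = nonNeg+nonNeg⇒nonNeg 1ℚ (fromℕ k) {{fromℕ-nonNegative k}}

∣sumFin∣≤ : ∀ {k} (g : Fin k → ℚ) {B} → (∀ j → ∣ g j ∣ ≤ B) → ∣ sumFin g ∣ ≤ fromℕ k * B
∣sumFin∣≤ {zero}  g {B} _     = ≤-reflexive (sym (*-zeroˡ B))
∣sumFin∣≤ {suc k} g {B} ∣g∣≤B = begin
  ∣ g zero + sumFin (g ∘ suc) ∣      ≤⟨ ∣p+q∣≤∣p∣+∣q∣ (g zero) (sumFin (g ∘ suc)) ⟩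
  ∣ g zero ∣ + ∣ sumFin (g ∘ suc) ∣  ≤⟨ +-mono-≤ (∣g∣≤B zero) (∣sumFin∣≤ (g ∘ suc) (∣g∣≤B ∘ suc)) ⟩
  B + fromℕ k * B                    ≡⟨ solve 2 (λ b n → b :+ n :* b := (con 1ℚ :+ n) :* b) refl B (fromℕ k) ⟩
  (1ℚ + fromℕ k) * B                 ∎
  where open ≤-Reasoning

^ℕ-+ : ∀ x a b → x ^ℕ (a ℕ.+ b) ≡ x ^ℕ a * x ^ℕ b
^ℕ-+ x zero    b = sym (*-identityˡ _)
^ℕ-+ x (suc a) b = trans (cong (x *_) (^ℕ-+ x a b)) (sym (*-assoc x _ _))

^ℕ-positive : ∀ x .{{_ : Positive x}} k → Positive (x ^ℕ k)
^ℕ-positive x zero    = _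
^ℕ-positive x (suc k) = pos*pos⇒pos x (x ^ℕ k) {{^ℕ-positive x k}}

^ℕ-≤-1 : ∀ x .{{_ : NonNegative x}} → x ≤ 1ℚ → ∀ k → x ^ℕ k ≤ 1ℚ
^ℕ-≤-1 x x≤1 zero    = ≤-refl
^ℕ-≤-1 x x≤1 (suc k) = begin
  x * x ^ℕ k ≤⟨ *-monoˡ-≤-nonNeg x (^ℕ-≤-1 x x≤1 k) ⟩
  x * 1ℚ     ≡⟨ *-identityʳ x ⟩
  x          ≤⟨ x≤1 ⟩
  1ℚ         ∎
  where open ≤-Reasoning

module Powers (ε : ℚ) (ε>0 : ε > 0ℚ) where

  ε^_ : ℤ → ℚ
  ε^_ = pow ε ε>0

  private
    instance
      ε-positive : Positive ε
      ε-positive = positive ε>0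
      ε-nonZero : NonZero ε
      ε-nonZero = >-nonZero ε>0

  pow-⊖ : ∀ a b → ε^ (a ⊖ b) ≡ ε ^ℕ a * (1/ ε) ^ℕ b
  pow-⊖ a       zero    = trans (cong ε^_ (ℤᵖ.⊖-≥ {a} {0} ℕ.z≤n)) (sym (*-identityʳ _))
  pow-⊖ zero    (suc b) = sym (*-identityˡ _)
  pow-⊖ (suc a) (suc b) = begin
    ε^ (suc a ⊖ suc b)                        ≡⟨ cong ε^_ (ℤᵖ.[1+m]⊖[1+n]≡m⊖n a b) ⟩
    ε^ (a ⊖ b)                                ≡⟨ pow-⊖ a b ⟩
    ε ^ℕ a * ε⁻¹ ^ℕ b                         ≡⟨ sym (*-identityˡ _) ⟩
    1ℚ * (ε ^ℕ a * ε⁻¹ ^ℕ b)                  ≡⟨ cong (_* (ε ^ℕ a * ε⁻¹ ^ℕ b)) (sym (*-inverseʳ ε)) ⟩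
    (ε * ε⁻¹) * (ε ^ℕ a * ε⁻¹ ^ℕ b)           ≡⟨ solve 4 (λ e f x y → (e :* f) :* (x :* y) := (e :* x) :* (f :* y)) refl ε ε⁻¹ (ε ^ℕ a) (ε⁻¹ ^ℕ b) ⟩
    (ε * ε ^ℕ a) * (ε⁻¹ * ε⁻¹ ^ℕ b)           ∎
    where
      open ≡-Reasoning
      ε⁻¹ = 1/ ε

  pow-+ : ∀ x y → ε^ (x ℤ.+ y) ≡ ε^ x * ε^ y
  pow-+ (+ a)    (+ b)    = ^ℕ-+ ε a b
  pow-+ (+ a)    -[1+ b ] = pow-⊖ a (suc b)
  pow-+ -[1+ a ] (+ b)    = trans (pow-⊖ b (suc a)) (*-comm (ε ^ℕ b) _)
  pow-+ -[1+ a ] -[1+ b ] = begin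
    ε⁻¹ * ε⁻¹ ^ℕ suc (a ℕ.+ b)     ≡⟨ cong (λ t → ε⁻¹ * ε⁻¹ ^ℕ t) (ℕᵖ.+-suc a b) ⟨
    ε⁻¹ * ε⁻¹ ^ℕ (a ℕ.+ suc b)     ≡⟨ cong (ε⁻¹ *_) (^ℕ-+ ε⁻¹ a (suc b)) ⟩
    ε⁻¹ * (ε⁻¹ ^ℕ a * ε^ -[1+ b ]) ≡⟨ *-assoc ε⁻¹ _ _ ⟨
    ε^ -[1+ a ] * ε^ -[1+ b ]     ∎
    where
      open ≡-Reasoning
      ε⁻¹ = 1/ ε

  pow-positive : ∀ z → Positive (ε^ z)
  pow-positive (+ k)    = ^ℕ-positive ε k
  pow-positive -[1+ k ] = ^ℕ-positive ((1/ ε) {{>-nonZero ε>0}}) {{1/pos⇒pos ε}} (suc k)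

  pow-nonNegative : ∀ z → NonNegative (ε^ z)
  pow-nonNegative z = pos⇒nonNeg (ε^ z) {{pow-positive z}}

  module _ (ε≤1 : ε ≤ 1ℚ) where

    pow-≤-1 : ∀ {z} → 0ℤ ℤ.≤ z → ε^ z ≤ 1ℚ
    pow-≤-1 {+ k} _ = ^ℕ-≤-1 ε {{pos⇒nonNeg ε}} ε≤1 k

    pow-antitone : ∀ {x y} → x ℤ.≤ y → ε^ y ≤ ε^ x
    pow-antitone {x} {y} x≤y = begin
      ε^ y                 ≡⟨ cong ε^_ (trans (sym (xyx⁻¹≈y x y)) (ℤᵖ.+-assoc x y (ℤ.- x))) ⟩
      ε^ (x ℤ.+ (y ℤ.- x)) ≡⟨ pow-+ x (y ℤ.- x) ⟩
      ε^ x * ε^ (y ℤ.- x)  ≤⟨ *-monoˡ-≤-nonNeg (ε^ x) {{pow-nonNegative x}} (pow-≤-1 (ℤᵖ.i≤j⇒0≤j-i x≤y)) ⟩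
      ε^ x * 1ℚ            ≡⟨ *-identityʳ (ε^ x) ⟩
      ε^ x                 ∎
      where
        open ≤-Reasoning
        open import Algebra.Properties.AbelianGroup ℤᵖ.+-0-abelianGroup using (xyx⁻¹≈y)

    pow-<⇒≤*ε : ∀ {x y} → x ℤ.< y → ε^ y ≤ ε^ x * ε
    pow-<⇒≤*ε {x} {y} x<y = begin
      ε^ y               ≤⟨ pow-antitone (ℤᵖ.i<j⇒suc[i]≤j x<y) ⟩
      ε^ (+ 1 ℤ.+ x)     ≡⟨ pow-+ (+ 1) x ⟩
      (ε * 1ℚ) * ε^ x    ≡⟨ cong (_* ε^ x) (*-identityʳ ε) ⟩
      ε * ε^ x           ≡⟨ *-comm ε (ε^ x) ⟩
      ε^ x * ε           ∎
      where open ≤-Reasoning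

StrictlyMonge : ∀ {k l} → (Fin k → Fin l → ℤ) → Set
StrictlyMonge b = ∀ {r r' c c'} → r Fin.< r' → c Fin.< c' → b r c ℤ.+ b r' c' ℤ.< b r c' ℤ.+ b r' c

StrictlyMonge-restrict : ∀ {k l k' l'} {b : Fin k → Fin l → ℤ} {f : Fin k' → Fin k} {g : Fin l' → Fin l} →
  StrictlyMonge b → StrictlyIncreasing f → StrictlyIncreasing g → StrictlyMonge (λ r c → b (f r) (g c))
StrictlyMonge-restrict monge f↑ g↑ r<r' c<c' = monge (f↑ _ _ r<r') (g↑ _ _ c<c')

suc-strictlyIncreasing : ∀ {k} → StrictlyIncreasing (suc {k})
suc-strictlyIncreasing _ _ i<j = ℕ.s≤s i<j

punchIn-strictlyIncreasing : ∀ {k} (j : Fin (suc k)) → StrictlyIncreasing (punchIn j)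
punchIn-strictlyIncreasing zero    x       y       x<y         = ℕ.s≤s x<y
punchIn-strictlyIncreasing (suc j) zero    (suc y) _           = ℕ.s≤s ℕ.z≤n
punchIn-strictlyIncreasing (suc j) (suc x) (suc y) (ℕ.s≤s x<y) = ℕ.s≤s (punchIn-strictlyIncreasing j x y x<y)

strictlyIncreasing⇒injective : ∀ {k m} {f : Fin k → Fin m} → StrictlyIncreasing f → Injective _≡_ _≡_ f
strictlyIncreasing⇒injective {f = f} f↑ {i} {j} fi≡fj with Finᵖ.<-cmp i j
... | tri< i<j _ _ = ⊥-elim (Finᵖ.<-irrefl fi≡fj (f↑ i j i<j))
... | tri≈ _ i≡j _ = i≡j
... | tri> _ _ j<i = ⊥-elim (Finᵖ.<-irrefl (sym fi≡fj) (f↑ j i j<i))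

trace : ∀ {k} → (Fin k → Fin k → ℤ) → ℤ
trace {zero}  b = 0ℤ
trace {suc k} b = b zero zero ℤ.+ trace (λ r c → b (suc r) (suc c))

withoutRow₀Col : ∀ {k} → (Fin (suc k) → Fin (suc k) → ℤ) → Fin (suc k) → Fin k → Fin k → ℤ
withoutRow₀Col b j r c = b (suc r) (punchIn j c)

StrictlyMonge-withoutRow₀Col : ∀ {k} (b : Fin (suc k) → Fin (suc k) → ℤ) →
  StrictlyMonge b → ∀ j → StrictlyMonge (withoutRow₀Col b j)
StrictlyMonge-withoutRow₀Col b monge j = StrictlyMonge-restrict {b = b} monge suc-strictlyIncreasing (punchIn-strictlyIncreasing j)

-- Swapping columns 0 and j+1 in the first two rows strictly lowers the diagonal sum, by the Monge inequality.
mutual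
  trace-≤-expansion : ∀ {k} (b : Fin (suc k) → Fin (suc k) → ℤ) → StrictlyMonge b →
    ∀ j → trace b ℤ.≤ b zero j ℤ.+ trace (withoutRow₀Col b j)
  trace-≤-expansion b monge zero    = ℤᵖ.≤-refl
  trace-≤-expansion b monge (suc j) = ℤᵖ.<⇒≤ (trace-<-expansion b monge j)

  trace-<-expansion : ∀ {k} (b : Fin (suc k) → Fin (suc k) → ℤ) → StrictlyMonge b →
    ∀ j → trace b ℤ.< b zero (suc j) ℤ.+ trace (withoutRow₀Col b (suc j))
  trace-<-expansion {suc k} b monge j = begin-strict
    b₀₀ ℤ.+ trace b'                  ≤⟨ ℤᵖ.+-monoʳ-≤ b₀₀ (trace-≤-expansion b' monge' j) ⟩
    b₀₀ ℤ.+ (b₁ⱼ ℤ.+ rest)            ≡⟨ ℤᵖ.+-assoc b₀₀ b₁ⱼ rest ⟨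
    (b₀₀ ℤ.+ b₁ⱼ) ℤ.+ rest            <⟨ ℤᵖ.+-monoˡ-< rest (monge (ℕ.s≤s ℕ.z≤n) (ℕ.s≤s ℕ.z≤n)) ⟩
    (b₀ⱼ ℤ.+ b₁₀) ℤ.+ rest            ≡⟨ ℤᵖ.+-assoc b₀ⱼ b₁₀ rest ⟩
    b₀ⱼ ℤ.+ (b₁₀ ℤ.+ rest)            ∎
    where
      open ℤᵖ.≤-Reasoning
      b' : Fin (suc k) → Fin (suc k) → ℤ
      b' r c = b (suc r) (suc c)
      monge' : StrictlyMonge b'
      monge' = StrictlyMonge-restrict {b = b} monge suc-strictlyIncreasing suc-strictlyIncreasing
      b₀₀ = b zero zero
      b₁₀ = b (suc zero) zero
      b₀ⱼ = b zero (suc j)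
      b₁ⱼ = b (suc zero) (suc j)
      rest = trace (withoutRow₀Col b' j)

det-2×2 : (A : Fin 2 → Fin 2 → ℚ) →
  det A ≡ A zero zero * A (suc zero) (suc zero) - A zero (suc zero) * A (suc zero) zero
det-2×2 A = solve 4 (λ a d b c → con 1ℚ :* (a :* (con 1ℚ :* (d :* con 1ℚ) :+ con 0ℚ))
                                 :+ ((:- con 1ℚ) :* (b :* (con 1ℚ :* (c :* con 1ℚ) :+ con 0ℚ)) :+ con 0ℚ)
                               := a :* d :- b :* c)
                    refl (A zero zero) (A (suc zero) (suc zero)) (A zero (suc zero)) (A (suc zero) zero)

pair : ∀ {m} → Fin m → Fin m → Fin 2 → Fin m
pair i i' zero    = i
pair i i' (suc _) = i'

pair-strictlyIncreasing : ∀ {m} {i i' : Fin m} → i Fin.< i' → StrictlyIncreasing (pair i i')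
pair-strictlyIncreasing i<i' zero    (suc zero) _ = i<i'
pair-strictlyIncreasing i<i' (suc zero) (suc zero) (ℕ.s≤s ())

twoPositive⇒StrictlyMonge : ∀ {m n} (a : Fin m → Fin n → ℤ) {ε} (ε>0 : ε > 0ℚ) → ε ≤ 1ℚ →
  TwoPositive (M a ε ε>0) → StrictlyMonge a
twoPositive⇒StrictlyMonge a {ε} ε>0 ε≤1 (_ , minors₂>0) {i} {i'} {j} {j'} i<i' j<j'
  with (a i j ℤ.+ a i' j') ℤᵖ.<? (a i j' ℤ.+ a i' j)
... | yes monge = monge
... | no  ¬monge = ⊥-elim (<-irrefl refl (<-≤-trans minor>0 minor≤0))
  where
    open Powers ε ε>0
    open ≤-Reasoning
    minor>0 : minor (M a ε ε>0) (pair i i') (pair j j') > 0ℚ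
    minor>0 = minors₂>0 (pair i i') (pair j j') (pair-strictlyIncreasing i<i') (pair-strictlyIncreasing j<j')
    s = a i j ℤ.+ a i' j'
    t = a i j' ℤ.+ a i' j
    minor≤0 : minor (M a ε ε>0) (pair i i') (pair j j') ≤ 0ℚ
    minor≤0 = begin
      minor (M a ε ε>0) (pair i i') (pair j j')               ≡⟨ det-2×2 (λ r c → ε^ a (pair i i' r) (pair j j' c)) ⟩
      ε^ a i j * ε^ a i' j' - ε^ a i j' * ε^ a i' j          ≡⟨ cong₂ _-_ (pow-+ (a i j) (a i' j')) (pow-+ (a i j') (a i' j)) ⟨
      ε^ s - ε^ t                                            ≤⟨ +-monoˡ-≤ (- ε^ t) (pow-antitone ε≤1 (ℤᵖ.≮⇒≥ ¬monge)) ⟩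
      ε^ t - ε^ t                                            ≡⟨ +-inverseʳ (ε^ t) ⟩
      0ℚ                                                     ∎

-- Expanding an order-(k+1) determinant along its first row gives one term with relative error K k · ε
-- and k further terms, each at most (1 + K k) · ε^trace · ε.
K : ℕ → ℚ
K zero    = 0ℚ
K (suc k) = K k + fromℕ k * (1ℚ + K k)

mutual
  K-nonNegative : ∀ k → NonNegative (K k)
  K-nonNegative zero    = _
  K-nonNegative (suc k) = nonNeg+nonNeg⇒nonNeg (K k) {{K-nonNegative k}} (fromℕ k * (1ℚ + K k))
    {{nonNeg*nonNeg⇒nonNeg (fromℕ k) {{fromℕ-nonNegative k}} (1ℚ + K k) {{1+K-nonNegative k}}}}

  1+K-nonNegative : ∀ k → NonNegative (1ℚ + K k)
  1+K-nonNegative k = nonNeg+nonNeg⇒nonNeg 1ℚ (K k) {{K-nonNegative k}}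

1+K-positive : ∀ m → Positive (1ℚ + K m)
1+K-positive m = pos+nonNeg⇒pos 1ℚ (K m) {{K-nonNegative m}}

K-monotone : ∀ {k l} → k ℕ.≤ l → K k ≤ K l
K-monotone k≤l = go (ℕᵖ.≤⇒≤′ k≤l)
  where
    go : ∀ {k l} → k ℕ.≤′ l → K k ≤ K l
    go ℕ.≤′-refl              = ≤-refl
    go (ℕ.≤′-step {l} k≤′l) = ≤-trans (go k≤′l)
      (p≤p+q (K l) _ {{nonNeg*nonNeg⇒nonNeg (fromℕ l) {{fromℕ-nonNegative l}} (1ℚ + K l) {{1+K-nonNegative l}}}})

module Estimate (ε : ℚ) (ε>0 : ε > 0ℚ) (ε≤1 : ε ≤ 1ℚ) where

  open Powers ε ε>0

  detPow : ∀ {k} → (Fin k → Fin k → ℤ) → ℚ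
  detPow b = det (λ r c → ε^ b r c)

  close⇒bounded : ∀ x y B .{{_ : NonNegative y}} .{{_ : NonNegative B}} →
    ∣ x - y ∣ ≤ B * (y * ε) → ∣ x ∣ ≤ (1ℚ + B) * y
  close⇒bounded x y B ∣x-y∣≤ = begin
    ∣ x ∣                   ≤⟨ ∣p∣≤∣p-q∣+∣q∣ x y ⟩
    ∣ x - y ∣ + ∣ y ∣        ≤⟨ +-mono-≤ ∣x-y∣≤ (≤-reflexive (0≤p⇒∣p∣≡p (nonNegative⁻¹ y))) ⟩
    B * (y * ε) + y          ≤⟨ +-monoˡ-≤ y (*-monoˡ-≤-nonNeg B (*-monoˡ-≤-nonNeg y ε≤1)) ⟩
    B * (y * 1ℚ) + y         ≡⟨ solve 2 (λ b y → b :* (y :* con 1ℚ) :+ y := (con 1ℚ :+ b) :* y) refl B y ⟩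
    (1ℚ + B) * y             ∎
    where open ≤-Reasoning

  expansionTerm : ∀ {k} → (Fin (suc k) → Fin (suc k) → ℤ) → Fin k → ℚ
  expansionTerm b j = sgn (suc j) * (ε^ b zero (suc j) * detPow (withoutRow₀Col b (suc j)))

  expansionTerm-bound : ∀ {k} (b : Fin (suc k) → Fin (suc k) → ℤ) → StrictlyMonge b → ∀ j →
    let bⱼ = withoutRow₀Col b (suc j) in
    ∣ detPow bⱼ - ε^ trace bⱼ ∣ ≤ K k * (ε^ trace bⱼ * ε) →
    ∣ expansionTerm b j ∣ ≤ (1ℚ + K k) * (ε^ trace b * ε)
  expansionTerm-bound {k} b monge j bⱼ-close = begin
    ∣ expansionTerm b j ∣                      ≡⟨ ∣sgn*p∣≡∣p∣ (suc j) (w * detPow bⱼ) ⟩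
    ∣ w * detPow bⱼ ∣                          ≡⟨ ∣p*q∣≡p*∣q∣ w (detPow bⱼ) {{w-nonNegative}} ⟩
    w * ∣ detPow bⱼ ∣                          ≤⟨ *-monoˡ-≤-nonNeg w {{w-nonNegative}} ∣detPow-bⱼ∣≤ ⟩
    w * ((1ℚ + K k) * ε^ trace bⱼ)             ≡⟨ solve 3 (λ w c d → w :* (c :* d) := c :* (w :* d)) refl w (1ℚ + K k) (ε^ trace bⱼ) ⟩
    (1ℚ + K k) * (w * ε^ trace bⱼ)             ≡⟨ cong ((1ℚ + K k) *_) (pow-+ (b zero (suc j)) (trace bⱼ)) ⟨
    (1ℚ + K k) * ε^ (b zero (suc j) ℤ.+ trace bⱼ)
      ≤⟨ *-monoˡ-≤-nonNeg (1ℚ + K k) {{1+K-nonNegative k}} (pow-<⇒≤*ε ε≤1 (trace-<-expansion b monge j)) ⟩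
    (1ℚ + K k) * (ε^ trace b * ε)              ∎
    where
      open ≤-Reasoning
      bⱼ = withoutRow₀Col b (suc j)
      w = ε^ b zero (suc j)
      w-nonNegative = pow-nonNegative (b zero (suc j))
      ∣detPow-bⱼ∣≤ : ∣ detPow bⱼ ∣ ≤ (1ℚ + K k) * ε^ trace bⱼ
      ∣detPow-bⱼ∣≤ = close⇒bounded (detPow bⱼ) (ε^ trace bⱼ) (K k) {{pow-nonNegative (trace bⱼ)}} {{K-nonNegative k}} bⱼ-close

  detPow-close : ∀ {k} (b : Fin k → Fin k → ℤ) → StrictlyMonge b →
    ∣ detPow b - ε^ trace b ∣ ≤ K k * (ε^ trace b * ε)
  detPow-close {zero}  b _     = ≤-reflexive (sym (*-zeroˡ (ε^ trace b * ε)))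
  -- detPow b unfolds to its first-row Laplace expansion 1 · (x · y) + T.
  detPow-close {suc k} b monge = begin
    ∣ detPow b - L ∣                                ≡⟨ cong (λ t → ∣ detPow b - t ∣) L≡x*z ⟩
    ∣ (1ℚ * (x * y) + T) - x * z ∣                   ≡⟨ cong ∣_∣ (solve 4 (λ x y z t → (con 1ℚ :* (x :* y) :+ t) :- x :* z := x :* (y :- z) :+ t) refl x y z T) ⟩
    ∣ x * (y - z) + T ∣                              ≤⟨ ∣p+q∣≤∣p∣+∣q∣ (x * (y - z)) T ⟩
    ∣ x * (y - z) ∣ + ∣ T ∣                           ≡⟨ cong (_+ ∣ T ∣) (∣p*q∣≡p*∣q∣ x (y - z) {{x-nonNegative}}) ⟩
    x * ∣ y - z ∣ + ∣ T ∣                             ≤⟨ +-mono-≤ (*-monoˡ-≤-nonNeg x {{x-nonNegative}} (detPow-close b₀ monge₀)) ∣T∣≤ ⟩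
    x * (K k * (z * ε)) + fromℕ k * ((1ℚ + K k) * (L * ε))
      ≡⟨ cong (λ t → x * (K k * (z * ε)) + fromℕ k * ((1ℚ + K k) * (t * ε))) L≡x*z ⟩
    x * (K k * (z * ε)) + fromℕ k * ((1ℚ + K k) * ((x * z) * ε))
      ≡⟨ solve 5 (λ x z e κ n → x :* (κ :* (z :* e)) :+ n :* ((con 1ℚ :+ κ) :* ((x :* z) :* e))
                              := (κ :+ n :* (con 1ℚ :+ κ)) :* ((x :* z) :* e)) refl x z ε (K k) (fromℕ k) ⟩
    K (suc k) * ((x * z) * ε)                       ≡⟨ cong (λ t → K (suc k) * (t * ε)) L≡x*z ⟨
    K (suc k) * (L * ε)                             ∎
    where
      open ≤-Reasoning
      b₀ = withoutRow₀Col b zero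
      monge₀ = StrictlyMonge-withoutRow₀Col b monge zero
      L = ε^ trace b
      x = ε^ b zero zero
      y = detPow b₀
      z = ε^ trace b₀
      T = sumFin (expansionTerm b)
      x-nonNegative = pow-nonNegative (b zero zero)
      L≡x*z : L ≡ x * z
      L≡x*z = pow-+ (b zero zero) (trace b₀)
      ∣T∣≤ : ∣ T ∣ ≤ fromℕ k * ((1ℚ + K k) * (L * ε))
      ∣T∣≤ = ∣sumFin∣≤ (expansionTerm b) {(1ℚ + K k) * (L * ε)} λ j →
        expansionTerm-bound b monge j (detPow-close (withoutRow₀Col b (suc j)) (StrictlyMonge-withoutRow₀Col b monge (suc j)))

  detPow-positive : ∀ {k} (b : Fin k → Fin k → ℤ) → StrictlyMonge b → K k * ε < 1ℚ → detPow b > 0ℚ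
  detPow-positive {k} b monge Kε<1 = begin-strict
    0ℚ                     <⟨ positive⁻¹ (L * (1ℚ - K k * ε)) {{pos*pos⇒pos L {{pow-positive (trace b)}} (1ℚ - K k * ε) {{positive 1-Kε>0}}}} ⟩
    L * (1ℚ - K k * ε)     ≡⟨ solve 3 (λ l κ e → l :* (con 1ℚ :- κ :* e) := l :- κ :* (l :* e)) refl L (K k) ε ⟩
    L - K k * (L * ε)      ≤⟨ ∣p-q∣≤r⇒q-r≤p (detPow-close b monge) ⟩
    detPow b               ∎
    where
      open ≤-Reasoning
      L = ε^ trace b
      1-Kε>0 : 1ℚ - K k * ε > 0ℚ
      1-Kε>0 = begin-strict
        0ℚ                 ≡⟨ +-inverseʳ (K k * ε) ⟨
        K k * ε - K k * ε  <⟨ +-monoˡ-< (- (K k * ε)) Kε<1 ⟩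
        1ℚ - K k * ε       ∎

threshold : ℕ → ℚ
threshold m = (1/ (1ℚ + K m)) {{pos⇒nonZero (1ℚ + K m) {{1+K-positive m}}}}

threshold-positive : ∀ m → threshold m > 0ℚ
threshold-positive m = positive⁻¹ (threshold m) {{1/pos⇒pos (1ℚ + K m) {{1+K-positive m}}}}

module BelowThreshold (m : ℕ) {ε : ℚ} (ε>0 : ε > 0ℚ) (ε<threshold : ε < threshold m) where

  private
    open ≤-Reasoning
    instance
      ε-nonNegative : NonNegative ε
      ε-nonNegative = pos⇒nonNeg ε {{positive ε>0}}
      Kε-nonNegative : NonNegative (K m * ε)
      Kε-nonNegative = nonNeg*nonNeg⇒nonNeg (K m) {{K-nonNegative m}} ε

  ε+Kε<1 : ε + K m * ε < 1ℚ
  ε+Kε<1 = begin-strict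
    ε + K m * ε           ≡⟨ solve 2 (λ e κ → e :+ κ :* e := (con 1ℚ :+ κ) :* e) refl ε (K m) ⟩
    (1ℚ + K m) * ε        <⟨ *-monoʳ-<-pos (1ℚ + K m) {{1+K-positive m}} ε<threshold ⟩
    (1ℚ + K m) * threshold m ≡⟨ *-inverseʳ (1ℚ + K m) {{pos⇒nonZero (1ℚ + K m) {{1+K-positive m}}}} ⟩
    1ℚ                    ∎

  ε≤1 : ε ≤ 1ℚ
  ε≤1 = ≤-trans (p≤p+q ε (K m * ε)) (<⇒≤ ε+Kε<1)

  Kε<1 : ∀ {k} → k ℕ.≤ m → K k * ε < 1ℚ
  Kε<1 {k} k≤m = begin-strict
    K k * ε        ≤⟨ *-monoʳ-≤-nonNeg ε (K-monotone k≤m) ⟩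
    K m * ε        ≤⟨ ≤-trans (p≤p+q (K m * ε) ε) (≤-reflexive (+-comm (K m * ε) ε)) ⟩
    ε + K m * ε    <⟨ ε+Kε<1 ⟩
    1ℚ             ∎

½<1 : ½ < 1ℚ
½<1 = from-yes (½ <? 1ℚ)

positive-below : ∀ {δ} → δ > 0ℚ → Σ ℚ (λ ε → ε > 0ℚ × ε < δ × ε ≤ 1ℚ)
positive-below {δ} δ>0 with δ ≤? 1ℚ
... | yes δ≤1 = δ * ½ , δ½>0 , δ½<δ , ≤-trans (<⇒≤ δ½<δ) δ≤1
  where
    δ½>0 : δ * ½ > 0ℚ
    δ½>0 = positive⁻¹ (δ * ½) {{pos*pos⇒pos δ {{positive δ>0}} ½}}
    δ½<δ : δ * ½ < δ
    δ½<δ = <-≤-trans (*-monoʳ-<-pos δ {{positive δ>0}} ½<1) (≤-reflexive (*-identityʳ δ))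
... | no  δ≰1 = ½ , from-yes (0ℚ <? ½) , <-trans ½<1 (≰⇒> δ≰1) , <⇒≤ ½<1

lemma4p4 : (m n : ℕ) (a : Fin m → Fin n → ℤ) →
    Σ ℚ (λ ε₀ → (ε₀ > 0ℚ) × ((ε : ℚ) (p : ε > 0ℚ) → ε < ε₀ → TwoPositive (M a ε p))) →
    Σ ℚ (λ ε₁ → (ε₁ > 0ℚ) × ((ε : ℚ) (p : ε > 0ℚ) → ε < ε₁ → TotallyPositive (M a ε p)))
lemma4p4 m n a (ε₀ , ε₀>0 , twoPositive) = threshold m , threshold-positive m , totallyPositive
  where
    monge : StrictlyMonge a
    monge with positive-below ε₀>0
    ... | ε , ε>0 , ε<ε₀ , ε≤1 = twoPositive⇒StrictlyMonge a ε>0 ε≤1 (twoPositive ε ε>0 ε<ε₀)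

    totallyPositive : (ε : ℚ) (p : ε > 0ℚ) → ε < threshold m → TotallyPositive (M a ε p)
    totallyPositive ε ε>0 ε<threshold k I J I↑ J↑ =
      Estimate.detPow-positive ε ε>0 ε≤1 (λ r c → a (I r) (J c))
        (StrictlyMonge-restrict {b = a} monge I↑ J↑)
        (Kε<1 (Finᵖ.injective⇒≤ (strictlyIncreasing⇒injective I↑)))
      where open BelowThreshold m ε>0 ε<threshold
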